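{- For all odd $n\geq1$, $\#E\Pi_n(1/2/3)=1$ and $\#O\Pi_n(1/2/3)=2^{n-1}-1$. For all even $n\geq2$, $\#E\Pi_n(1/2/3)=2^{n-1}-1$ and $\#O\Pi_n(1/2/3)=1$.
   Context: $\Pi_n$ is the set of set partitions of $[n]=\{1,\dots,n\}$. For $\pi\in\Pi_m$ and $\sigma\in\Pi_n$, $\sigma$ contains the pattern $\pi$ if there is $S\subseteq[n]$ with $\#S=m$ such that the restriction $\{B\cap S: B\in\sigma,\ B\cap S\neq\emptyset\}$, relabeled by the order-preserving bijection $S\to[m]$, equals $\pi$; otherwise $\sigma$ avoids $\pi$. $\Pi_n(R)$ is the set of $\sigma\in\Pi_n$ avoiding every pattern in $R$. Here $1/2/3=\{\{1\},\{2\},\{3\}\}$. The sign of $\sigma\in\Pi_n$ with $k$ blocks is $\mathrm{sgn}(\sigma)=(-1)^{n-k}$; $\sigma$ is even if $\mathrm{sgn}(\sigma)=1$ and odd if $\mathrm{sgn}(\sigma)=-1$. $E\Pi_n(R)$ and $O\Pi_n(R)$ denote the sets of even, respectively odd, partitions in $\Pi_n(R)$. -}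

module Defs where

open import Data.Bool using (Bool; true; false; _∧_; not)
open import Data.Nat using (ℕ; zero; suc; _+_; _∸_; _≡ᵇ_)
open import Data.List using (List; []; _∷_; _++_; map; length; filterᵇ; concatMap; upTo; [_])
open import Data.List.Properties using (≡-dec)
open import Data.Product using (_×_; _,_; proj₁)
open import Relation.Nullary.Decidable using (⌊_⌋)
import Data.Nat as ℕ

-- A set partition σ of [n] is represented canonically by its restricted
-- growth string (RGS) w = w₁ … wₙ (0-based block labels): wᵢ is the index of
-- the block containing i, where blocks are numbered 0,1,2,… in increasing
-- order of their minimal elements.  This is a bijection Π_n ≅ RGS of length n.

extend : List ℕ × ℕ → List (List ℕ × ℕ)
extend (w , k) = map (λ j → (w ++ [ j ]) , k) (upTo k) ++ [ (w ++ [ k ]) , suc k ]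

partitionsWithBlocks : ℕ → List (List ℕ × ℕ)
partitionsWithBlocks zero    = [ [] , 0 ]
partitionsWithBlocks (suc n) = concatMap extend (partitionsWithBlocks n)

Π : ℕ → List (List ℕ)
Π n = map proj₁ (partitionsWithBlocks n)

indexOf : ℕ → List ℕ → ℕ
indexOf x []       = 0
indexOf x (y ∷ ys) = if x ≡ᵇ y then 0 else suc (indexOf x ys)
  where open import Data.Bool using (if_then_else_)

isIn : ℕ → List ℕ → Bool
isIn x []       = false
isIn x (y ∷ ys) = if x ≡ᵇ y then true else isIn x ys
  where open import Data.Bool using (if_then_else_)

-- Relabel a sequence of block labels in order of first occurrence;
-- applied to the labels of the elements of S (in increasing order) this
-- yields the RGS of the restriction of σ to S, relabelled by S → [#S].
standardise' : List ℕ → List ℕ → List ℕ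
standardise' seen []       = []
standardise' seen (x ∷ xs) with isIn x seen
... | true  = indexOf x seen ∷ standardise' seen xs
... | false = length seen ∷ standardise' (seen ++ [ x ]) xs

standardise : List ℕ → List ℕ
standardise = standardise' []

subsequences : List ℕ → List (List ℕ)
subsequences []       = [ [] ]
subsequences (x ∷ xs) = map (x ∷_) (subsequences xs) ++ subsequences xs

eqList : List ℕ → List ℕ → Bool
eqList u v = ⌊ ≡-dec ℕ._≟_ u v ⌋

contains : List ℕ → List ℕ → Bool
contains σ π = any (λ s → (length s ≡ᵇ length π) ∧ eqList (standardise s) π) (subsequences σ)
  where open import Data.Bool.ListAction using (any)

avoids : List ℕ → List ℕ → Bool
avoids σ π = not (contains σ π)

blocks : List ℕ → ℕ
blocks σ = length (dedup σ)
  where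
  dedup : List ℕ → List ℕ
  dedup = go []
    where
    go : List ℕ → List ℕ → List ℕ
    go seen []       = seen
    go seen (x ∷ xs) with isIn x seen
    ... | true  = go seen xs
    ... | false = go (seen ++ [ x ]) xs

evenᵇ : ℕ → Bool
evenᵇ zero          = true
evenᵇ (suc zero)    = false
evenᵇ (suc (suc n)) = evenᵇ n

-- sgn σ = (-1)^(n-k); σ even iff n - k is even.
isEvenPartition : List ℕ → Bool
isEvenPartition σ = evenᵇ (length σ ∸ blocks σ)

ΠAvoid : ℕ → List ℕ → List (List ℕ)
ΠAvoid n π = filterᵇ (λ σ → avoids σ π) (Π n)

#EΠ : ℕ → List ℕ → ℕ
#EΠ n π = length (filterᵇ isEvenPartition (ΠAvoid n π))

#OΠ : ℕ → List ℕ → ℕ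
#OΠ n π = length (filterᵇ (λ σ → not (isEvenPartition σ)) (ΠAvoid n π))

p1/2/3 : List ℕ
p1/2/3 = 0 ∷ 1 ∷ 2 ∷ []

{-# OPTIONS --safe #-}
module Submission where

-- A partition contains 1/2/3 exactly when three of its letters (in restricted
-- growth form) are pairwise distinct, i.e. when it has at least three blocks.
-- So for n ≥ 1 the avoiders are the one-block partition, of sign (-1)^(n-1),
-- and the S(n,2) partitions with two blocks, of sign (-1)^(n-2).  The
-- enumeration `extend` gives a partition with k blocks k children with k
-- blocks and one with k+1, whence S(n+1,k+1) = (k+1) S(n,k+1) + S(n,k),
-- S(n,1) = 1 and S(n,2) = 2^(n-1) - 1.

open import Defs
open import Data.Bool using (Bool; true; false; _∧_; _∨_; not; if_then_else_)
open import Data.Bool.ListAction using (any; or)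
open import Data.Bool.Properties using (∨-assoc; ∨-identityʳ; ∨-zeroʳ; T-≡)
open import Function.Bundles using (Equivalence)
open import Data.Nat using (ℕ; zero; suc; _+_; _*_; _∸_; _^_; _%_; _≡ᵇ_; _<_; _≥_; z<s; s<s)
open import Data.Nat.Properties using (≡ᵇ⇒≡; *-zeroʳ; +-comm; m+n∸n≡m; m≤n⇒m≤1+n; n<1+n)
open import Data.Nat.Tactic.RingSolver using (solve-∀)
open import Data.List using (List; []; _∷_; _++_; [_]; map; length; filterᵇ; concatMap; upTo)
open import Data.List.Properties
  using (length-++; filter-++; map-++; map-∘; map-concatMap; concatMap-map; concatMap-cong; length-upTo)
open import Data.List.Membership.Propositional using (_∈_)
open import Data.List.Relation.Unary.All as All using (All; []; _∷_)
open import Data.List.Relation.Unary.All.Properties using (++⁺; map⁺; concat⁺; applyUpTo⁺₁)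
open import Data.List.Relation.Unary.Any using (here; there)
open import Data.List.Relation.Unary.Any.Properties using (++⁺ˡ; ++⁺ʳ)
open import Data.Product using (_×_; _,_; proj₁; proj₂)
open import Relation.Binary.PropositionalEquality using (_≡_; refl; sym; trans; cong; cong₂; module ≡-Reasoning)

private
  variable
    A B : Set
    p q : A → Bool
    x y z j k m n : ℕ
    r w : List ℕ

countᵇ : (A → Bool) → List A → ℕ
countᵇ p xs = length (filterᵇ p xs)

countᵇ-∷ : ∀ (p : A → Bool) a xs → countᵇ p (a ∷ xs) ≡ countᵇ p [ a ] + countᵇ p xs
countᵇ-∷ p a xs with p a
... | true  = refl
... | false = refl

countᵇ-++ : ∀ (p : A → Bool) xs ys → countᵇ p (xs ++ ys) ≡ countᵇ p xs + countᵇ p ys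
countᵇ-++ p xs ys = trans (cong length (filter-++ _ xs ys)) (length-++ (filterᵇ p xs))

countᵇ-map : ∀ (f : A → B) xs → countᵇ p (map f xs) ≡ countᵇ (λ a → p (f a)) xs
countᵇ-map f [] = refl
countᵇ-map {p = p} f (a ∷ xs) with p (f a)
... | true  = cong suc (countᵇ-map f xs)
... | false = countᵇ-map f xs

countᵇ-cong : ∀ {xs : List A} → All (λ a → p a ≡ q a) xs → countᵇ p xs ≡ countᵇ q xs
countᵇ-cong [] = refl
countᵇ-cong {p = p} {q = q} {a ∷ xs} (pa≡qa ∷ eqs) with p a | q a
... | true  | true  = cong suc (countᵇ-cong eqs)
... | false | false = countᵇ-cong eqs
... | true  | false with () ← pa≡qa
... | false | true  with () ← pa≡qa

countᵇ-filterᵇ : ∀ (xs : List A) → countᵇ q (filterᵇ p xs) ≡ countᵇ (λ a → p a ∧ q a) xs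
countᵇ-filterᵇ [] = refl
countᵇ-filterᵇ {q = q} {p = p} (a ∷ xs) with p a
... | false = countᵇ-filterᵇ xs
... | true with q a
...   | true  = cong suc (countᵇ-filterᵇ xs)
...   | false = countᵇ-filterᵇ xs

multiplicity : ℕ → List ℕ → ℕ
multiplicity k = countᵇ (_≡ᵇ k)

multiplicity-const : ∀ (xs : List A) → multiplicity k (map (λ _ → j) xs) ≡ length xs * multiplicity k [ j ]
multiplicity-const [] = refl
multiplicity-const {k = k} {j = j} (_ ∷ xs) =
  trans (countᵇ-∷ (_≡ᵇ k) j _) (cong (multiplicity k [ j ] +_) (multiplicity-const xs))

multiplicity-suc : ∀ k j → multiplicity (suc k) [ suc j ] ≡ multiplicity k [ j ]
multiplicity-suc k j with j ≡ᵇ k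
... | true  = refl
... | false = refl

multiplicity-scale : ∀ j k → j * multiplicity k [ j ] ≡ k * multiplicity k [ j ]
multiplicity-scale j k with j ≡ᵇ k in j≡k
... | true  = cong (_* 1) (≡ᵇ⇒≡ j k (Equivalence.from T-≡ j≡k))
... | false = trans (*-zeroʳ j) (sym (*-zeroʳ k))

extendedBlockCounts : ℕ → List ℕ
extendedBlockCounts k = map (λ _ → k) (upTo k) ++ [ suc k ]

multiplicity-extendedBlockCounts : ∀ j →
  multiplicity k (extendedBlockCounts j) ≡ k * multiplicity k [ j ] + multiplicity k [ suc j ]
multiplicity-extendedBlockCounts {k} j = begin
  multiplicity k (extendedBlockCounts j)
    ≡⟨ countᵇ-++ (_≡ᵇ k) (map (λ _ → j) (upTo j)) [ suc j ] ⟩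
  multiplicity k (map (λ _ → j) (upTo j)) + multiplicity k [ suc j ]
    ≡⟨ cong (_+ multiplicity k [ suc j ]) (multiplicity-const (upTo j)) ⟩
  length (upTo j) * multiplicity k [ j ] + multiplicity k [ suc j ]
    ≡⟨ cong (λ l → l * multiplicity k [ j ] + multiplicity k [ suc j ]) (length-upTo j) ⟩
  j * multiplicity k [ j ] + multiplicity k [ suc j ]
    ≡⟨ cong (_+ multiplicity k [ suc j ]) (multiplicity-scale j k) ⟩
  k * multiplicity k [ j ] + multiplicity k [ suc j ] ∎
  where open ≡-Reasoning

multiplicity-concatMap-zero : ∀ L → multiplicity 0 (concatMap extendedBlockCounts L) ≡ 0
multiplicity-concatMap-zero [] = refl
multiplicity-concatMap-zero (j ∷ L) = begin
  multiplicity 0 (extendedBlockCounts j ++ concatMap extendedBlockCounts L)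
    ≡⟨ countᵇ-++ (_≡ᵇ 0) (extendedBlockCounts j) _ ⟩
  multiplicity 0 (extendedBlockCounts j) + multiplicity 0 (concatMap extendedBlockCounts L)
    ≡⟨ cong₂ _+_ (multiplicity-extendedBlockCounts j) (multiplicity-concatMap-zero L) ⟩
  0 ∎
  where open ≡-Reasoning

multiplicity-concatMap-suc : ∀ L → multiplicity (suc k) (concatMap extendedBlockCounts L)
                                   ≡ suc k * multiplicity (suc k) L + multiplicity k L
multiplicity-concatMap-suc {k} [] = cong (_+ 0) (sym (*-zeroʳ (suc k)))
multiplicity-concatMap-suc {k} (j ∷ L) = begin
  multiplicity (suc k) (extendedBlockCounts j ++ concatMap extendedBlockCounts L)
    ≡⟨ countᵇ-++ (_≡ᵇ suc k) (extendedBlockCounts j) _ ⟩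
  multiplicity (suc k) (extendedBlockCounts j) + multiplicity (suc k) (concatMap extendedBlockCounts L)
    ≡⟨ cong₂ _+_ (trans (multiplicity-extendedBlockCounts j) (cong (suc k * a +_) (multiplicity-suc k j)))
                 (multiplicity-concatMap-suc L) ⟩
  (suc k * a + b) + (suc k * as + bs)
    ≡⟨ regroup (suc k) a b as bs ⟩
  suc k * (a + as) + (b + bs)
    ≡⟨ sym (cong₂ (λ u v → suc k * u + v) (countᵇ-∷ (_≡ᵇ suc k) j L) (countᵇ-∷ (_≡ᵇ k) j L)) ⟩
  suc k * multiplicity (suc k) (j ∷ L) + multiplicity k (j ∷ L) ∎
  where
  open ≡-Reasoning
  a = multiplicity (suc k) [ j ]
  b = multiplicity k [ j ]
  as = multiplicity (suc k) L
  bs = multiplicity k L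
  regroup : ∀ c a b as bs → (c * a + b) + (c * as + bs) ≡ c * (a + as) + (b + bs)
  regroup = solve-∀

blockCounts : ℕ → List ℕ
blockCounts n = map proj₂ (partitionsWithBlocks n)

blockCounts-suc : ∀ n → blockCounts (suc n) ≡ concatMap extendedBlockCounts (blockCounts n)
blockCounts-suc n = begin
  map proj₂ (concatMap extend L)                    ≡⟨ map-concatMap proj₂ extend L ⟩
  concatMap (λ σk → map proj₂ (extend σk)) L        ≡⟨ concatMap-cong extend-blockCounts L ⟩
  concatMap (λ σk → extendedBlockCounts (proj₂ σk)) L ≡⟨ concatMap-map extendedBlockCounts proj₂ L ⟨
  concatMap extendedBlockCounts (map proj₂ L)       ∎
  where
  open ≡-Reasoning
  L = partitionsWithBlocks n
  extend-blockCounts : ∀ σk → map proj₂ (extend σk) ≡ extendedBlockCounts (proj₂ σk)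
  extend-blockCounts (w , k) =
    trans (map-++ proj₂ (map (λ j → w ++ [ j ] , k) (upTo k)) _)
          (cong (_++ [ suc k ]) (sym (map-∘ (upTo k))))

stirling₂ : ℕ → ℕ → ℕ
stirling₂ n k = multiplicity k (blockCounts n)

stirling₂-suc-zero : ∀ n → stirling₂ (suc n) 0 ≡ 0
stirling₂-suc-zero n =
  trans (cong (multiplicity 0) (blockCounts-suc n)) (multiplicity-concatMap-zero (blockCounts n))

stirling₂-suc-suc : ∀ n k → stirling₂ (suc n) (suc k) ≡ suc k * stirling₂ n (suc k) + stirling₂ n k
stirling₂-suc-suc n k =
  trans (cong (multiplicity (suc k)) (blockCounts-suc n)) (multiplicity-concatMap-suc (blockCounts n))

stirling₂-suc-one : ∀ n → stirling₂ (suc n) 1 ≡ 1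
stirling₂-suc-one zero = refl
stirling₂-suc-one (suc n) = begin
  stirling₂ (suc (suc n)) 1                             ≡⟨ stirling₂-suc-suc (suc n) 0 ⟩
  1 * stirling₂ (suc n) 1 + stirling₂ (suc n) 0         ≡⟨ cong₂ (λ a b → 1 * a + b) (stirling₂-suc-one n) (stirling₂-suc-zero n) ⟩
  1                                                     ∎
  where open ≡-Reasoning

stirling₂-suc-two+1 : ∀ n → stirling₂ (suc n) 2 + 1 ≡ 2 ^ n
stirling₂-suc-two+1 zero = refl
stirling₂-suc-two+1 (suc n) = begin
  stirling₂ (suc (suc n)) 2 + 1                         ≡⟨ cong (_+ 1) (stirling₂-suc-suc (suc n) 1) ⟩
  2 * stirling₂ (suc n) 2 + stirling₂ (suc n) 1 + 1     ≡⟨ cong (λ b → 2 * stirling₂ (suc n) 2 + b + 1) (stirling₂-suc-one n) ⟩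
  2 * stirling₂ (suc n) 2 + 1 + 1                       ≡⟨ double-suc (stirling₂ (suc n) 2) ⟩
  2 * (stirling₂ (suc n) 2 + 1)                         ≡⟨ cong (2 *_) (stirling₂-suc-two+1 n) ⟩
  2 * 2 ^ n                                             ∎
  where
  open ≡-Reasoning
  double-suc : ∀ a → 2 * a + 1 + 1 ≡ 2 * (a + 1)
  double-suc = solve-∀

stirling₂-suc-two : ∀ n → stirling₂ (suc n) 2 ≡ 2 ^ n ∸ 1
stirling₂-suc-two n = trans (sym (m+n∸n≡m (stirling₂ (suc n) 2) 1)) (cong (_∸ 1) (stirling₂-suc-two+1 n))

any-++ : ∀ (p : A → Bool) xs ys → any p (xs ++ ys) ≡ any p xs ∨ any p ys
any-++ p []       ys = refl
any-++ p (a ∷ xs) ys = trans (cong (p a ∨_) (any-++ p xs ys)) (sym (∨-assoc (p a) _ _))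

any-const-false : ∀ (xs : List A) → any (λ _ → false) xs ≡ false
any-const-false []       = refl
any-const-false (_ ∷ xs) = any-const-false xs

any-subsequences-∷ : ∀ (p : List ℕ → Bool) x xs →
  any p (subsequences (x ∷ xs)) ≡ any (λ s → p (x ∷ s)) (subsequences xs) ∨ any p (subsequences xs)
any-subsequences-∷ p x xs =
  trans (any-++ p (map (x ∷_) (subsequences xs)) (subsequences xs))
        (cong (λ b → or b ∨ any p (subsequences xs)) (sym (map-∘ (subsequences xs))))

∨-preserves-true : ∀ {a b a′ b′} → (a ≡ true → a′ ≡ true) → (b ≡ true → b′ ≡ true) →
                   a ∨ b ≡ true → a′ ∨ b′ ≡ true
∨-preserves-true {true}  f g _ = cong (_∨ _) (f refl)
∨-preserves-true {false} f g h = trans (cong (_ ∨_) (g h)) (∨-zeroʳ _)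

distinct₃ : ℕ → ℕ → ℕ → Bool
distinct₃ x y z = not (y ≡ᵇ x) ∧ not (z ≡ᵇ x) ∧ not (z ≡ᵇ y)

distinctTripleFrom₂ : ℕ → ℕ → List ℕ → Bool
distinctTripleFrom₂ x y = any (distinct₃ x y)

distinctTripleFrom₁ : ℕ → List ℕ → Bool
distinctTripleFrom₁ x []       = false
distinctTripleFrom₁ x (y ∷ ys) = distinctTripleFrom₂ x y ys ∨ distinctTripleFrom₁ x ys

hasDistinctTriple : List ℕ → Bool
hasDistinctTriple []       = false
hasDistinctTriple (x ∷ xs) = distinctTripleFrom₁ x xs ∨ hasDistinctTriple xs

isOccurrence : List ℕ → Bool
isOccurrence s = (length s ≡ᵇ 3) ∧ eqList (standardise s) p1/2/3

-- `indexOf` repeats the comparisons made by `isIn`, hence the rewrites.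
standardise-triple : ∀ x y z → eqList (standardise (x ∷ y ∷ z ∷ [])) p1/2/3 ≡ distinct₃ x y z
standardise-triple x y z with y ≡ᵇ x in y≡x
... | true rewrite y≡x = refl
... | false with z ≡ᵇ x in z≡x
...   | true rewrite z≡x = refl
...   | false with z ≡ᵇ y in z≡y
...     | true rewrite z≡x | z≡y = refl
...     | false = refl

occurrences-from₃ : ∀ x y z vs → any (λ s → isOccurrence (x ∷ y ∷ z ∷ s)) (subsequences vs) ≡ distinct₃ x y z
occurrences-from₃ x y z []       = trans (∨-identityʳ _) (standardise-triple x y z)
occurrences-from₃ x y z (v ∷ vs) =
  trans (any-subsequences-∷ _ v vs)
        (cong₂ _∨_ (any-const-false (subsequences vs)) (occurrences-from₃ x y z vs))

occurrences-from₂ : ∀ x y zs → any (λ s → isOccurrence (x ∷ y ∷ s)) (subsequences zs) ≡ distinctTripleFrom₂ x y zs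
occurrences-from₂ x y []       = refl
occurrences-from₂ x y (z ∷ zs) =
  trans (any-subsequences-∷ _ z zs) (cong₂ _∨_ (occurrences-from₃ x y z zs) (occurrences-from₂ x y zs))

occurrences-from₁ : ∀ x ys → any (λ s → isOccurrence (x ∷ s)) (subsequences ys) ≡ distinctTripleFrom₁ x ys
occurrences-from₁ x []       = refl
occurrences-from₁ x (y ∷ ys) =
  trans (any-subsequences-∷ _ y ys) (cong₂ _∨_ (occurrences-from₂ x y ys) (occurrences-from₁ x ys))

contains-1/2/3 : ∀ w → contains w p1/2/3 ≡ hasDistinctTriple w
contains-1/2/3 []       = refl
contains-1/2/3 (x ∷ xs) =
  trans (any-subsequences-∷ isOccurrence x xs) (cong₂ _∨_ (occurrences-from₁ x xs) (contains-1/2/3 xs))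

distinct₃-binary : x < 2 → y < 2 → z < 2 → distinct₃ x y z ≡ false
distinct₃-binary z<s       z<s       _         = refl
distinct₃-binary (s<s z<s) (s<s z<s) _         = refl
distinct₃-binary z<s       (s<s z<s) z<s       = refl
distinct₃-binary z<s       (s<s z<s) (s<s z<s) = refl
distinct₃-binary (s<s z<s) z<s       z<s       = refl
distinct₃-binary (s<s z<s) z<s       (s<s z<s) = refl

distinctTripleFrom₂-binary : x < 2 → y < 2 → All (_< 2) r → distinctTripleFrom₂ x y r ≡ false
distinctTripleFrom₂-binary x<2 y<2 []          = refl
distinctTripleFrom₂-binary x<2 y<2 (z<2 ∷ r<2) =
  cong₂ _∨_ (distinct₃-binary x<2 y<2 z<2) (distinctTripleFrom₂-binary x<2 y<2 r<2)

distinctTripleFrom₁-binary : x < 2 → All (_< 2) r → distinctTripleFrom₁ x r ≡ false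
distinctTripleFrom₁-binary x<2 []          = refl
distinctTripleFrom₁-binary x<2 (y<2 ∷ r<2) =
  cong₂ _∨_ (distinctTripleFrom₂-binary x<2 y<2 r<2) (distinctTripleFrom₁-binary x<2 r<2)

hasDistinctTriple-binary : All (_< 2) w → hasDistinctTriple w ≡ false
hasDistinctTriple-binary []          = refl
hasDistinctTriple-binary (x<2 ∷ w<2) =
  cong₂ _∨_ (distinctTripleFrom₁-binary x<2 w<2) (hasDistinctTriple-binary w<2)

distinctTripleFrom₂-++ : ∀ zs vs → distinctTripleFrom₂ x y zs ≡ true → distinctTripleFrom₂ x y (zs ++ vs) ≡ true
distinctTripleFrom₂-++ {x} {y} zs vs t = trans (any-++ (distinct₃ x y) zs vs) (cong (_∨ _) t)

distinctTripleFrom₁-++ : ∀ ys vs → distinctTripleFrom₁ x ys ≡ true → distinctTripleFrom₁ x (ys ++ vs) ≡ true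
distinctTripleFrom₁-++ []       _  ()
distinctTripleFrom₁-++ {x} (y ∷ ys) vs =
  ∨-preserves-true (distinctTripleFrom₂-++ {x} {y} ys vs) (distinctTripleFrom₁-++ ys vs)

hasDistinctTriple-++ : ∀ w vs → hasDistinctTriple w ≡ true → hasDistinctTriple (w ++ vs) ≡ true
hasDistinctTriple-++ []       _  ()
hasDistinctTriple-++ (x ∷ xs) vs =
  ∨-preserves-true (distinctTripleFrom₁-++ xs vs) (hasDistinctTriple-++ xs vs)

distinctTripleFrom₁-new : 1 ∈ r → distinctTripleFrom₁ 0 (r ++ [ 2 ]) ≡ true
distinctTripleFrom₁-new {1 ∷ r} (here refl) =
  cong (_∨ distinctTripleFrom₁ 0 (r ++ [ 2 ])) (trans (any-++ (distinct₃ 0 1) r [ 2 ]) (∨-zeroʳ _))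
distinctTripleFrom₁-new {y ∷ r} (there 1∈r) =
  trans (cong (distinctTripleFrom₂ 0 y (r ++ [ 2 ]) ∨_) (distinctTripleFrom₁-new 1∈r)) (∨-zeroʳ _)

All<1⇒All<2 : All (_< 1) r → All (_< 2) r
All<1⇒All<2 = All.map m≤n⇒m≤1+n

-- All that 1/2/3 and `blocks` see of a restricted growth string with k blocks.
data BlockShape : ℕ → List ℕ → Set where
  none : BlockShape 0 []
  one  : All (_< 1) r → BlockShape 1 (0 ∷ r)
  two  : All (_< 2) r → 1 ∈ r → BlockShape 2 (0 ∷ r)
  many : hasDistinctTriple w ≡ true → BlockShape (3 + k) w

BlockShape-++-old : BlockShape k w → j < k → BlockShape k (w ++ [ j ])
BlockShape-++-old none            ()
BlockShape-++-old (one r<1)       j<1 = one (++⁺ r<1 (j<1 ∷ []))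
BlockShape-++-old (two r<2 1∈r)   j<2 = two (++⁺ r<2 (j<2 ∷ [])) (++⁺ˡ 1∈r)
BlockShape-++-old {w = w} (many t) _  = many (hasDistinctTriple-++ w _ t)

BlockShape-++-new : BlockShape k w → BlockShape (suc k) (w ++ [ k ])
BlockShape-++-new none                = one []
BlockShape-++-new (one {r} r<1)       = two (++⁺ (All<1⇒All<2 r<1) (n<1+n 1 ∷ [])) (++⁺ʳ r (here refl))
BlockShape-++-new (two {r} _ 1∈r)     = many (cong (_∨ hasDistinctTriple (r ++ [ 2 ])) (distinctTripleFrom₁-new 1∈r))
BlockShape-++-new {w = w} (many t)    = many (hasDistinctTriple-++ w _ t)

Shaped : ℕ → List ℕ × ℕ → Set
Shaped n (w , k) = length w ≡ n × BlockShape k w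

extend-shaped : ∀ {σk} → Shaped n σk → All (Shaped (suc n)) (extend σk)
extend-shaped {n} {w , k} (len , shape) =
  ++⁺ (map⁺ (applyUpTo⁺₁ (λ j → j) k (λ j<k → length-snoc , BlockShape-++-old shape j<k)))
      ((length-snoc , BlockShape-++-new shape) ∷ [])
  where
  length-snoc : length (w ++ [ j ]) ≡ suc n
  length-snoc = trans (length-++ w) (trans (+-comm (length w) 1) (cong suc len))

partitionsWithBlocks-shaped : ∀ n → All (Shaped n) (partitionsWithBlocks n)
partitionsWithBlocks-shaped zero    = (refl , none) ∷ []
partitionsWithBlocks-shaped (suc n) = concat⁺ (map⁺ (All.map extend-shaped (partitionsWithBlocks-shaped n)))

-- `blocks` works through a local helper, so it is evaluated on known prefixes only.
blocks-one : All (_< 1) r → blocks (0 ∷ r) ≡ 1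
blocks-one []          = refl
blocks-one (z<s ∷ r<1) = blocks-one r<1

blocks-zero-one : All (_< 2) r → blocks (0 ∷ 1 ∷ r) ≡ 2
blocks-zero-one []              = refl
blocks-zero-one (z<s     ∷ r<2) = blocks-zero-one r<2
blocks-zero-one (s<s z<s ∷ r<2) = blocks-zero-one r<2

blocks-two : All (_< 2) r → 1 ∈ r → blocks (0 ∷ r) ≡ 2
blocks-two (_       ∷ r<2) (here refl) = blocks-zero-one r<2
blocks-two (z<s     ∷ r<2) (there 1∈r) = blocks-two r<2 1∈r
blocks-two (s<s z<s ∷ r<2) (there _)   = blocks-zero-one r<2

not-evenᵇ-suc : ∀ n → not (evenᵇ (suc n)) ≡ evenᵇ n
not-evenᵇ-suc zero          = refl
not-evenᵇ-suc (suc zero)    = refl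
not-evenᵇ-suc (suc (suc n)) = not-evenᵇ-suc n

isEvenPartition-one : All (_< 1) r → isEvenPartition (0 ∷ r) ≡ evenᵇ (length r)
isEvenPartition-one {r} r<1 = cong (λ b → evenᵇ (suc (length r) ∸ b)) (blocks-one r<1)

isEvenPartition-two : All (_< 2) r → 1 ∈ r → isEvenPartition (0 ∷ r) ≡ not (evenᵇ (length r))
isEvenPartition-two {_ ∷ r} r<2 1∈r =
  trans (cong (λ b → evenᵇ (suc (suc (length r)) ∸ b)) (blocks-two r<2 1∈r)) (sym (not-evenᵇ-suc (length r)))

avoids-1/2/3 : ∀ w → avoids w p1/2/3 ≡ not (hasDistinctTriple w)
avoids-1/2/3 w = cong not (contains-1/2/3 w)

avoids-binary : All (_< 2) r → avoids (0 ∷ r) p1/2/3 ≡ true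
avoids-binary {r} r<2 = trans (avoids-1/2/3 (0 ∷ r)) (cong not (hasDistinctTriple-binary (z<s ∷ r<2)))

signedAvoider-blocks : BlockShape k w → length w ≡ suc m →
    (avoids w p1/2/3 ∧ isEvenPartition w ≡ (k ≡ᵇ (if evenᵇ m then 1 else 2)))
  × (avoids w p1/2/3 ∧ not (isEvenPartition w) ≡ (k ≡ᵇ (if evenᵇ m then 2 else 1)))
signedAvoider-blocks none ()
signedAvoider-blocks (one {r} r<1) refl
  rewrite avoids-binary (All<1⇒All<2 r<1) | isEvenPartition-one r<1 with evenᵇ (length r)
... | true  = refl , refl
... | false = refl , refl
signedAvoider-blocks (two {r} r<2 1∈r) refl
  rewrite avoids-binary r<2 | isEvenPartition-two r<2 1∈r with evenᵇ (length r)
... | true  = refl , refl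
... | false = refl , refl
signedAvoider-blocks {m = m} (many {w} t) _
  rewrite avoids-1/2/3 w | t with evenᵇ m
... | true  = refl , refl
... | false = refl , refl

countᵇ-ΠAvoid≡stirling₂ : ∀ (f : List ℕ → Bool) π n c →
  All (λ σk → avoids (proj₁ σk) π ∧ f (proj₁ σk) ≡ (proj₂ σk ≡ᵇ c)) (partitionsWithBlocks n) →
  countᵇ f (ΠAvoid n π) ≡ stirling₂ n c
countᵇ-ΠAvoid≡stirling₂ f π n c classify = begin
  countᵇ f (filterᵇ (λ σ → avoids σ π) (map proj₁ L))          ≡⟨ countᵇ-filterᵇ (map proj₁ L) ⟩
  countᵇ (λ σ → avoids σ π ∧ f σ) (map proj₁ L)               ≡⟨ countᵇ-map proj₁ L ⟩
  countᵇ (λ σk → avoids (proj₁ σk) π ∧ f (proj₁ σk)) L        ≡⟨ countᵇ-cong classify ⟩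
  countᵇ (λ σk → proj₂ σk ≡ᵇ c) L                             ≡⟨ countᵇ-map proj₂ L ⟨
  stirling₂ n c                                               ∎
  where
  open ≡-Reasoning
  L = partitionsWithBlocks n

#EΠ-suc : ∀ m → #EΠ (suc m) p1/2/3 ≡ stirling₂ (suc m) (if evenᵇ m then 1 else 2)
#EΠ-suc m = countᵇ-ΠAvoid≡stirling₂ isEvenPartition p1/2/3 (suc m) _
  (All.map (λ (len , shape) → proj₁ (signedAvoider-blocks shape len)) (partitionsWithBlocks-shaped (suc m)))

#OΠ-suc : ∀ m → #OΠ (suc m) p1/2/3 ≡ stirling₂ (suc m) (if evenᵇ m then 2 else 1)
#OΠ-suc m = countᵇ-ΠAvoid≡stirling₂ (λ σ → not (isEvenPartition σ)) p1/2/3 (suc m) _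
  (All.map (λ (len , shape) → proj₂ (signedAvoider-blocks shape len)) (partitionsWithBlocks-shaped (suc m)))

evenᵇ≡suc%2≡ᵇ1 : ∀ m → evenᵇ m ≡ (suc m % 2 ≡ᵇ 1)
evenᵇ≡suc%2≡ᵇ1 zero          = refl
evenᵇ≡suc%2≡ᵇ1 (suc zero)    = refl
evenᵇ≡suc%2≡ᵇ1 (suc (suc m)) = evenᵇ≡suc%2≡ᵇ1 m

proposition4p3 : (∀ (n : ℕ) → n ≥ 1 → n % 2 ≡ 1 →
                    (#EΠ n p1/2/3 ≡ 1) × (#OΠ n p1/2/3 ≡ 2 ^ (n ∸ 1) ∸ 1))
               × (∀ (n : ℕ) → n ≥ 2 → n % 2 ≡ 0 →
                    (#EΠ n p1/2/3 ≡ 2 ^ (n ∸ 1) ∸ 1) × (#OΠ n p1/2/3 ≡ 1))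
proposition4p3 = odd , even
  where
  odd : ∀ n → n ≥ 1 → n % 2 ≡ 1 → (#EΠ n p1/2/3 ≡ 1) × (#OΠ n p1/2/3 ≡ 2 ^ (n ∸ 1) ∸ 1)
  odd zero    () _
  odd (suc m) _  n-odd
    rewrite #EΠ-suc m | #OΠ-suc m | trans (evenᵇ≡suc%2≡ᵇ1 m) (cong (_≡ᵇ 1) n-odd) =
    stirling₂-suc-one m , stirling₂-suc-two m

  even : ∀ n → n ≥ 2 → n % 2 ≡ 0 → (#EΠ n p1/2/3 ≡ 2 ^ (n ∸ 1) ∸ 1) × (#OΠ n p1/2/3 ≡ 1)
  even zero    () _
  even (suc m) _  n-even
    rewrite #EΠ-suc m | #OΠ-suc m | trans (evenᵇ≡suc%2≡ᵇ1 m) (cong (_≡ᵇ 1) n-even) =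
    stirling₂-suc-two m , stirling₂-suc-one m
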